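{- Let $I$ be a finite set of agents and $C$ a finite set of contracts, each contract $c\in C$ having a nonempty set of participants $P(c)\subseteq I$. For $S\subseteq C$ and $i\in I$ let $S(i)=\{s\in S: i\in P(s)\}$. For each $i\in I$ let $f_i$ be a Plott choice function on $C(i)$, and let $\preceq_i$ be the relation on subsets of $C(i)$ given by $A\preceq_i B$ if and only if $f_i(A\cup B)\subseteq B$. Let $S\subseteq C$ be a stable system, and let $T\subseteq C$ be a system satisfying $f_i(T(i))=T(i)$ for every $i\in I$. If $S(i)\preceq_i T(i)$ for every $i\in I$, then $S=T$.
   Context: A choice function on a finite set $X$ is a map $f:2^X\to 2^X$ with $f(A)\subseteq A$ for all $A\subseteq X$. It is a Plott function if $f(A\cup B)=f(f(A)\cup B)$ for all $A,B\subseteq X$. A system $S\subseteq C$ is stable (with respect to the choice functions $f_i$) if (S0) $f_i(S(i))=S(i)$ for every $i\in I$, and (S*) for every contract $b\in C\setminus S$ there is some $i\in P(b)$ with $b\notin f_i(S(i)\cup\{b\})$. -}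

module Defs where

open import Data.Nat using (ℕ)
open import Data.Fin using (Fin)
open import Data.Fin.Subset using (Subset; _∈_; _∉_; _⊆_; _∪_; _∩_; ⁅_⁆; Nonempty)
open import Data.Vec using (tabulate; lookup)
open import Data.Product using (Σ; _×_)
open import Relation.Binary.PropositionalEquality using (_≡_)

-- Agents are Fin m, contracts are Fin n.
-- A participant map assigns to each contract its set of agents P(c) ⊆ I.
Participants : ℕ → ℕ → Set
Participants m n = Fin n → Subset m

contractsOf : ∀ {m n} → Participants m n → Fin m → Subset n
contractsOf P i = tabulate (λ c → lookup (P c) i)

restrict : ∀ {m n} → Participants m n → Subset n → Fin m → Subset n
restrict P S i = S ∩ contractsOf P i

-- A choice function on the ground set D ⊆ C (only its values on subsets of D matter).
IsChoiceOn : ∀ {n} → Subset n → (Subset n → Subset n) → Set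
IsChoiceOn D f = ∀ A → A ⊆ D → f A ⊆ A

IsPlottOn : ∀ {n} → Subset n → (Subset n → Subset n) → Set
IsPlottOn D f = ∀ A B → A ⊆ D → B ⊆ D → f (A ∪ B) ≡ f (f A ∪ B)

IsPlottFunctionOn : ∀ {n} → Subset n → (Subset n → Subset n) → Set
IsPlottFunctionOn D f = IsChoiceOn D f × IsPlottOn D f

Pref : ∀ {n} → (Subset n → Subset n) → Subset n → Subset n → Set
Pref f A B = f (A ∪ B) ⊆ B

Acceptable : ∀ {m n} → Participants m n → (Fin m → Subset n → Subset n) → Subset n → Set
Acceptable P f S = ∀ i → f i (restrict P S i) ≡ restrict P S i

Stable : ∀ {m n} → Participants m n → (Fin m → Subset n → Subset n) → Subset n → Set
Stable P f S =
  Acceptable P f S ×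
  (∀ b → b ∉ S → Σ _ λ i → i ∈ P b × b ∉ f i (restrict P S i ∪ ⁅ b ⁆))

{-# OPTIONS --safe #-}
-- If b ∈ T \ S, pick the agent i with b ∉ f_i(S(i) ∪ {b}) given by stability.
-- Path independence and S(i) ≼ T(i) force f_i(S(i) ∪ T(i)) = f_i(T(i)) = T(i) ∋ b,
-- yet splitting S(i) ∪ T(i) as (S(i) ∪ {b}) ∪ (T(i) - b) shows that b can only be
-- chosen from it if b ∈ f_i(S(i) ∪ {b}). Hence T ⊆ S, so S(i) ∪ T(i) = S(i), and
-- then S(i) = f_i(S(i)) ⊆ T(i) for a participant i of any b ∈ S gives S ⊆ T.
module Submission where

open import Defs
open import Data.Nat using (ℕ)
open import Data.Fin using (Fin; _≟_)
open import Data.Fin.Subset using (Subset; Nonempty; _∈_; _∉_; _⊆_; _∪_; _─_; _-_; ⁅_⁆; inside; outside)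
open import Data.Fin.Subset.Properties
open import Data.Vec using (_∷_; here; there; lookup)
open import Data.Vec.Properties using (lookup∘tabulate; []=⇒lookup; lookup⇒[]=)
open import Data.Product using (_,_)
open import Data.Sum using (inj₁; inj₂; [_,_]′)
open import Function using (id)
open import Relation.Nullary using (yes; no; contradiction)
open import Relation.Binary.PropositionalEquality using (_≡_; refl; sym; trans; cong; subst; module ≡-Reasoning)

private
  variable
    n : ℕ
    p q r : Subset n

∪-lub : p ⊆ r → q ⊆ r → p ∪ q ⊆ r
∪-lub {p = p} {q = q} p⊆r q⊆r x∈p∪q with x∈p∪q⁻ p q x∈p∪q
... | inj₁ x∈p = p⊆r x∈p
... | inj₂ x∈q = q⊆r x∈q

q⊆p⇒p∪q≡p : q ⊆ p → p ∪ q ≡ p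
q⊆p⇒p∪q≡p {q = q} q⊆p = ⊆-antisym (∪-lub ⊆-refl q⊆p) (p⊆p∪q q)

x∈p─q⇒x∉q : ∀ {x : Fin n} → x ∈ p ─ q → x ∉ q
x∈p─q⇒x∉q {p = _ ∷ _} {q = outside ∷ _} here       ()
x∈p─q⇒x∉q {p = _ ∷ _} {q = inside  ∷ _} ()         here
x∈p─q⇒x∉q {p = _ ∷ _} {q = outside ∷ _} (there x∈) (there x∈q) = x∈p─q⇒x∉q x∈ x∈q
x∈p─q⇒x∉q {p = _ ∷ _} {q = inside  ∷ _} (there x∈) (there x∈q) = x∈p─q⇒x∉q x∈ x∈q

⁅x⁆⊆p : ∀ {x : Fin n} → x ∈ p → ⁅ x ⁆ ⊆ p
⁅x⁆⊆p {p = p} {x = x} x∈p y∈⁅x⁆ = subst (_∈ p) (sym (x∈⁅y⁆⇒x≡y x y∈⁅x⁆)) x∈p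

x∈p⇒⁅x⁆∪p-x≡p : ∀ {x : Fin n} → x ∈ p → ⁅ x ⁆ ∪ (p - x) ≡ p
x∈p⇒⁅x⁆∪p-x≡p {p = p} {x = x} x∈p = ⊆-antisym (∪-lub (⁅x⁆⊆p x∈p) (p─q⊆p p ⁅ x ⁆)) split
  where
  split : p ⊆ ⁅ x ⁆ ∪ (p - x)
  split {y} y∈p with y ≟ x
  ... | yes refl = p⊆p∪q (p - x) (x∈⁅x⁆ x)
  ... | no  y≢x  = q⊆p∪q ⁅ x ⁆ (p - x) (x∈p∧x≢y⇒x∈p-y y∈p y≢x)

module _ {D : Subset n} {f : Subset n → Subset n} where

  f[p∪q]⊆f[p]∪q : IsPlottFunctionOn D f → p ⊆ D → q ⊆ D → f (p ∪ q) ⊆ f p ∪ q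
  f[p∪q]⊆f[p]∪q {p = p} {q = q} (choice , plott) p⊆D q⊆D rewrite plott p q p⊆D q⊆D =
    choice (f p ∪ q) (∪-lub (⊆-trans (choice p p⊆D) p⊆D) q⊆D)

  Pref⇒f[p∪q]≡f[q] : IsPlottOn D f → p ⊆ D → q ⊆ D → Pref f p q → f (p ∪ q) ≡ f q
  Pref⇒f[p∪q]≡f[q] {p = p} {q = q} plott p⊆D q⊆D p≼q = begin
    f (p ∪ q)            ≡⟨ cong f (q⊆p⇒p∪q≡p (q⊆p∪q p q)) ⟨
    f ((p ∪ q) ∪ q)      ≡⟨ plott (p ∪ q) q (∪-lub p⊆D q⊆D) q⊆D ⟩
    f (f (p ∪ q) ∪ q)    ≡⟨ cong f (trans (∪-comm (f (p ∪ q)) q) (q⊆p⇒p∪q≡p p≼q)) ⟩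
    f q                  ∎
    where open ≡-Reasoning

  x∈q⇒x∈f[p∪⁅x⁆] : IsPlottFunctionOn D f → p ⊆ D → q ⊆ D → Pref f p q → f q ≡ q →
                    ∀ {x} → x ∈ q → x ∈ f (p ∪ ⁅ x ⁆)
  x∈q⇒x∈f[p∪⁅x⁆] {p = p} {q = q} plottFn@(_ , plott) p⊆D q⊆D p≼q fq≡q {x} x∈q =
    [ id , (λ x∈q-x → contradiction (x∈⁅x⁆ x) (x∈p─q⇒x∉q x∈q-x)) ]′
      (x∈p∪q⁻ (f (p ∪ ⁅ x ⁆)) (q - x) (f[split]⊆ x∈f[split]))
    where
    split : (p ∪ ⁅ x ⁆) ∪ (q - x) ≡ p ∪ q
    split = trans (∪-assoc p ⁅ x ⁆ (q - x)) (cong (p ∪_) (x∈p⇒⁅x⁆∪p-x≡p x∈q))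
    f[split]⊆ : f ((p ∪ ⁅ x ⁆) ∪ (q - x)) ⊆ f (p ∪ ⁅ x ⁆) ∪ (q - x)
    f[split]⊆ = f[p∪q]⊆f[p]∪q plottFn (∪-lub p⊆D (⊆-trans (⁅x⁆⊆p x∈q) q⊆D)) (⊆-trans (p─q⊆p q ⁅ x ⁆) q⊆D)
    x∈f[split] : x ∈ f ((p ∪ ⁅ x ⁆) ∪ (q - x))
    x∈f[split] rewrite split | Pref⇒f[p∪q]≡f[q] plott p⊆D q⊆D p≼q | fq≡q = x∈q

module _ {m : ℕ} (P : Participants m n) where

  ∈contractsOf⁺ : ∀ {i c} → i ∈ P c → c ∈ contractsOf P i
  ∈contractsOf⁺ {i} {c} i∈P =
    lookup⇒[]= c _ (trans (lookup∘tabulate (λ c → lookup (P c) i) c) ([]=⇒lookup i∈P))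

  ∈restrict⁺ : ∀ {S i c} → c ∈ S → i ∈ P c → c ∈ restrict P S i
  ∈restrict⁺ c∈S i∈P = x∈p∩q⁺ (c∈S , ∈contractsOf⁺ i∈P)

  ∈restrict⁻ : ∀ {S i c} → c ∈ restrict P S i → c ∈ S
  ∈restrict⁻ {S} = p∩q⊆p S _

  restrict⊆contractsOf : ∀ S i → restrict P S i ⊆ contractsOf P i
  restrict⊆contractsOf S i = p∩q⊆q S (contractsOf P i)

  restrict-mono : ∀ {S T} i → S ⊆ T → restrict P S i ⊆ restrict P T i
  restrict-mono {S} i S⊆T c∈ = x∈p∩q⁺ (S⊆T (∈restrict⁻ c∈) , restrict⊆contractsOf S i c∈)

proposition2p1 : (m n : ℕ) (P : Participants m n) → (∀ c → Nonempty (P c)) →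
    (f : Fin m → Subset n → Subset n) →
    (∀ i → IsPlottFunctionOn (contractsOf P i) (f i)) →
    (S T : Subset n) → Stable P f S → Acceptable P f T →
    (∀ i → Pref (f i) (restrict P S i) (restrict P T i)) →
    S ≡ T
proposition2p1 m n P nonempty f plottFn S T (accS , blocked) accT S≼T = ⊆-antisym S⊆T T⊆S
  where
  T⊆S : T ⊆ S
  T⊆S {b} b∈T with b ∈? S
  ... | yes b∈S = b∈S
  ... | no  b∉S with blocked b b∉S
  ...   | i , i∈P , b∉f = contradiction
    (x∈q⇒x∈f[p∪⁅x⁆] (plottFn i) (restrict⊆contractsOf P S i) (restrict⊆contractsOf P T i)
                    (S≼T i) (accT i) (∈restrict⁺ P b∈T i∈P))
    b∉f

  S⊆T : S ⊆ T
  S⊆T {b} b∈S with nonempty b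
  ... | i , i∈P = ∈restrict⁻ P (S≼T i b∈f[S∪T])
    where
    b∈f[S∪T] : b ∈ f i (restrict P S i ∪ restrict P T i)
    b∈f[S∪T] rewrite q⊆p⇒p∪q≡p (restrict-mono P i T⊆S) | accS i = ∈restrict⁺ P b∈S i∈P
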